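{- Let $\Gamma$ be the graph on vertices $v_0,\dots,v_{19}$ (indices mod $20$) which is the edge-disjoint union of the Hamilton cycle $\Sigma=(v_0v_1v_2\cdots v_{19})$, the two pentagons $P_0=(v_0v_4v_8v_{12}v_{16})$ and $P_1=(v_2v_6v_{10}v_{14}v_{18})$, and the two pentagrams $Q_0=(v_1v_9v_{17}v_5v_{13})$ and $Q_1=(v_3v_{11}v_{19}v_7v_{15})$ (each written as a cyclic sequence of vertices, consecutive ones adjacent). Then $\Gamma$ is a $20$-vertex $4$-regular graph of girth $5$. Let $F_0^0=\{v_0v_1,v_4v_5,v_8v_9,v_{12}v_{13},v_{16}v_{17}\}$, $F_0^1=\{v_0v_{19},v_4v_3,v_8v_7,v_{12}v_{11},v_{16}v_{15}\}$, $F_1^0=\{v_2v_1,v_6v_5,v_{10}v_9,v_{14}v_{13},v_{18}v_{17}\}$, $F_1^1=\{v_2v_3,v_6v_7,v_{10}v_{11},v_{14}v_{15},v_{18}v_{19}\}$. Then $E(\Sigma)=F_0^0\cup F_0^1\cup F_1^0\cup F_1^1$, and for each $i,j\in\{0,1\}$ the subgraph $P_i\cup Q_j\cup F_i^j$ is isomorphic to the Petersen graph. Consider the following coloring with colors $\{0,1,2,3,4\}$: vertex $v_i$ gets color $(2-i)\bmod 5$; the edge $v_iv_{i+1}$ of $\Sigma$ gets color $c_{i \bmod 10}$ where $(c_0,\dots,c_9)=(3,4,1,2,4,0,2,3,0,1)$; the edges $v_0v_4,v_4v_8,v_8v_{12},v_{12}v_{16},v_{16}v_0$ get colors $0,1,2,3,4$;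 the edges $v_2v_6,v_6v_{10},v_{10}v_{14},v_{14}v_{18},v_{18}v_2$ get colors $3,4,0,1,2$; the edges $v_1v_9,v_9v_{17},v_{17}v_5,v_5v_{13},v_{13}v_1$ get colors $2,4,1,3,0$; the edges $v_3v_{11},v_{11}v_{19},v_{19}v_7,v_7v_{15},v_{15}v_3$ get colors $0,2,4,1,3$. This is a total coloring of $\Gamma$ that is not efficient. Moreover, $\Gamma$ contains exactly $54$ cycles of length $5$, of which exactly $14$ have both their vertex set and their edge set in bijective correspondence with the color set $\{0,1,2,3,4\}$ under this coloring; the remaining $40$ five-cycles do not have this property.
   Context: A total coloring (TC) assigns colors to vertices and edges so that adjacent vertices, edges sharing an endpoint, and an edge and its endpoints all receive different colors. For a connected $k$-regular graph, a TC with colors $\{0,\dots,k\}$ is efficient if for every vertex $v$ the vertices of the closed neighborhood $N[v]$ receive pairwise distinct colors and each vertex color class is an efficient dominating set (independent set $S$ such that every vertex outside $S$ has exactly one neighbor in $S$). Here $k=4$. -}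

module Defs where

open import Data.Nat using (ℕ; zero; suc; _≤_; _≡ᵇ_; _∸_; _%_)
open import Data.Fin using (Fin; toℕ) renaming (_<_ to _<ᶠ_)
open import Data.Bool using (Bool; true; false; if_then_else_; _∧_; _∨_)
open import Data.List using (List; []; _∷_; _++_; [_]; zip; map; length; upTo)
open import Data.List.Relation.Unary.Any using (Any)
open import Data.List.Relation.Unary.All using (All)
open import Data.List.Relation.Unary.Unique.Propositional using (Unique)
open import Data.List.Membership.Propositional using (_∈_)
open import Data.List.Relation.Binary.Permutation.Propositional using (_↭_)
open import Data.Product using (_×_; _,_; ∃-syntax)
open import Data.Sum using (_⊎_)
open import Data.Empty using (⊥)
open import Relation.Binary.PropositionalEquality using (_≡_; _≢_)
open import Relation.Nullary using (¬_)
open import Function.Bundles using (_⇔_)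
open import Function.Definitions using (Injective)

closedPairs : {A : Set} → List A → List (A × A)
closedPairs []       = []
closedPairs (x ∷ xs) = zip (x ∷ xs) (xs ++ [ x ])

EdgeIn : List (ℕ × ℕ) → ℕ → ℕ → Set
EdgeIn es u v = Any (λ e → (e ≡ (u , v)) ⊎ (e ≡ (v , u))) es

coloredCycle : List ℕ → List ℕ → List (ℕ × ℕ × ℕ)
coloredCycle vs cs = map (λ { ((a , b) , c) → (a , b , c) }) (zip (closedPairs vs) cs)

uncolor : List (ℕ × ℕ × ℕ) → List (ℕ × ℕ)
uncolor = map (λ { (a , b , c) → (a , b) })

findCol : List (ℕ × ℕ × ℕ) → ℕ → ℕ → ℕ
findCol [] u v = 0
findCol ((a , b , c) ∷ t) u v =
  if ((a ≡ᵇ u) ∧ (b ≡ᵇ v)) ∨ ((a ≡ᵇ v) ∧ (b ≡ᵇ u)) then c else findCol t u v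

module GraphNotions {V : Set} (Adj : V → V → Set) where

  IsCycle : List V → Set
  IsCycle xs = (3 ≤ length xs) × Unique xs × All (λ { (a , b) → Adj a b }) (closedPairs xs)

  HasDegree : V → ℕ → Set
  HasDegree v d = ∃[ L ] ((length L ≡ d) × Unique L × (∀ u → (Adj v u ⇔ (u ∈ L))))

  Regular : ℕ → Set
  Regular d = ∀ v → HasDegree v d

  HasGirth : ℕ → Set
  HasGirth g = (∃[ xs ] (IsCycle xs × (length xs ≡ g)))
             × (∀ xs → IsCycle xs → g ≤ length xs)

  IsTotalColoring : ℕ → (V → ℕ) → (V → V → ℕ) → Set
  IsTotalColoring k vc ec =
      (∀ v → vc v ≤ k)
    × (∀ u v → Adj u v → ec u v ≤ k)
    × (∀ u v → Adj u v → ec u v ≡ ec v u)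
    × (∀ u v → Adj u v → vc u ≢ vc v)
    × (∀ u v w → Adj u v → Adj u w → v ≢ w → ec u v ≢ ec u w)
    × (∀ u v → Adj u v → ec u v ≢ vc u)

  InClosedNbd : V → V → Set
  InClosedNbd v u = (u ≡ v) ⊎ Adj v u

  IsEfficientDominating : (V → Set) → Set
  IsEfficientDominating S =
      (∀ x y → S x → S y → ¬ Adj x y)
    × (∀ x → ¬ S x → ∃[ y ] (Adj x y × S y × (∀ z → Adj x z → S z → z ≡ y)))

  IsEfficientTC : ℕ → (V → ℕ) → (V → V → ℕ) → Set
  IsEfficientTC k vc ec =
      IsTotalColoring k vc ec
    × (∀ v u w → InClosedNbd v u → InClosedNbd v w → u ≢ w → vc u ≢ vc w)
    × (∀ c → c ≤ k → IsEfficientDominating (λ x → vc x ≡ c))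

petersenEdges : List (ℕ × ℕ)
petersenEdges = closedPairs (0 ∷ 1 ∷ 2 ∷ 3 ∷ 4 ∷ [])
             ++ closedPairs (5 ∷ 7 ∷ 9 ∷ 6 ∷ 8 ∷ [])
             ++ (0 , 5) ∷ (1 , 6) ∷ (2 , 7) ∷ (3 , 8) ∷ (4 , 9) ∷ []

PetersenAdj : Fin 10 → Fin 10 → Set
PetersenAdj a b = EdgeIn petersenEdges (toℕ a) (toℕ b)

IsoToPetersen : List ℕ → List (ℕ × ℕ) → Set
IsoToPetersen vs es =
  ∃[ f ] ( Injective {A = Fin 10} {B = Fin 20} _≡_ _≡_ f
         × (∀ a → toℕ (f a) ∈ vs)
         × (∀ (v : Fin 20) → toℕ v ∈ vs → ∃[ a ] (f a ≡ v))
         × (∀ a b → (PetersenAdj a b ⇔ EdgeIn es (toℕ (f a)) (toℕ (f b)))) )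

cseq : ℕ → ℕ
cseq 0 = 3
cseq 1 = 4
cseq 2 = 1
cseq 3 = 2
cseq 4 = 4
cseq 5 = 0
cseq 6 = 2
cseq 7 = 3
cseq 8 = 0
cseq 9 = 1
cseq _ = 0

SigmaV P0V P1V Q0V Q1V : List ℕ
SigmaV = upTo 20
P0V = 0 ∷ 4 ∷ 8 ∷ 12 ∷ 16 ∷ []
P1V = 2 ∷ 6 ∷ 10 ∷ 14 ∷ 18 ∷ []
Q0V = 1 ∷ 9 ∷ 17 ∷ 5 ∷ 13 ∷ []
Q1V = 3 ∷ 11 ∷ 19 ∷ 7 ∷ 15 ∷ []

SigmaC P0C P1C Q0C Q1C : List (ℕ × ℕ × ℕ)
SigmaC = coloredCycle SigmaV (map (λ i → cseq (i % 10)) (upTo 20))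
P0C = coloredCycle P0V (0 ∷ 1 ∷ 2 ∷ 3 ∷ 4 ∷ [])
P1C = coloredCycle P1V (3 ∷ 4 ∷ 0 ∷ 1 ∷ 2 ∷ [])
Q0C = coloredCycle Q0V (2 ∷ 4 ∷ 1 ∷ 3 ∷ 0 ∷ [])
Q1C = coloredCycle Q1V (0 ∷ 2 ∷ 4 ∷ 1 ∷ 3 ∷ [])

GammaC : List (ℕ × ℕ × ℕ)
GammaC = SigmaC ++ P0C ++ P1C ++ Q0C ++ Q1C

component : Fin 5 → List (ℕ × ℕ)
component Fin.zero = closedPairs SigmaV
component (Fin.suc Fin.zero) = closedPairs P0V
component (Fin.suc (Fin.suc Fin.zero)) = closedPairs P1V
component (Fin.suc (Fin.suc (Fin.suc Fin.zero))) = closedPairs Q0V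
component (Fin.suc (Fin.suc (Fin.suc (Fin.suc Fin.zero)))) = closedPairs Q1V

GammaE : List (ℕ × ℕ)
GammaE = closedPairs SigmaV ++ closedPairs P0V ++ closedPairs P1V
      ++ closedPairs Q0V ++ closedPairs Q1V

Adj : Fin 20 → Fin 20 → Set
Adj u v = EdgeIn GammaE (toℕ u) (toℕ v)

open GraphNotions Adj public

-- vertex v_i gets color (2 - i) mod 5  (= (22 - i) mod 5 for 0 ≤ i ≤ 19)
vcol : Fin 20 → ℕ
vcol v = (22 ∸ toℕ v) % 5

ecol : Fin 20 → Fin 20 → ℕ
ecol u v = findCol GammaC (toℕ u) (toℕ v)

F00 F01 F10 F11 : List (ℕ × ℕ)
F00 = (0 , 1) ∷ (4 , 5) ∷ (8 , 9) ∷ (12 , 13) ∷ (16 , 17) ∷ []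
F01 = (0 , 19) ∷ (4 , 3) ∷ (8 , 7) ∷ (12 , 11) ∷ (16 , 15) ∷ []
F10 = (2 , 1) ∷ (6 , 5) ∷ (10 , 9) ∷ (14 , 13) ∷ (18 , 17) ∷ []
F11 = (2 , 3) ∷ (6 , 7) ∷ (10 , 11) ∷ (14 , 15) ∷ (18 , 19) ∷ []

PQF : List ℕ → List ℕ → List (ℕ × ℕ) → List (ℕ × ℕ)
PQF p q f = closedPairs p ++ closedPairs q ++ f

-- canonical representative of a cycle (a0 a1 a2 a3 a4): a0 is the
-- smallest vertex and a1 < a4 (fixes rotation and direction), so that
-- canonical lists correspond bijectively to 5-cycles of Γ (as subgraphs)
Canonical5 : List (Fin 20) → Set
Canonical5 (a ∷ b ∷ c ∷ d ∷ e ∷ []) =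
  (a <ᶠ b) × (a <ᶠ c) × (a <ᶠ d) × (a <ᶠ e) × (b <ᶠ e)
Canonical5 _ = ⊥

FiveCycle : List (Fin 20) → Set
FiveCycle xs = IsCycle xs × Canonical5 xs

colorSet : List ℕ
colorSet = upTo 5

Rainbow : List (Fin 20) → Set
Rainbow xs = (map vcol xs ↭ colorSet)
           × (map (λ { (a , b) → ecol a b }) (closedPairs xs) ↭ colorSet)

-- All claims are finite checks, settled by evaluating decision procedures. The one structural
-- idea is that a cycle through a is a walk from a along the neighbour lists, so the cycles on
-- k + 1 vertices are found among the 20·4^k such walks: for k = 2, 3 there are none (girth 5),
-- and for k = 4 the canonical ones are the 54 five-cycles, which are then split by the rainbow
-- test (two permutation tests, decided by comparing sorted lists).
module Submission where

open import Defs
open import Data.Nat using (ℕ; zero; suc; _≤_; _+_; _∸_; _%_; s≤s; z≤n; _≤?_)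
open import Data.Nat.DivMod using (_mod_)
import Data.Nat.Properties as ℕ
open import Data.Nat.Properties using (≤-decTotalOrder; ≤-totalOrder)
open import Data.Fin using (Fin; toℕ; #_)
import Data.Fin.Properties as Fin
open import Data.Bool using (if_then_else_)
open import Data.List using (List; []; _∷_; [_]; _++_; length; map; zip; concatMap; filter; allFin)
open import Data.List.Properties using (≡-dec)
import Data.List.Relation.Unary.All.Properties as All
open import Data.List.Sort.InsertionSort.Base ≤-decTotalOrder using (sort)
open import Data.List.Sort.InsertionSort.Properties ≤-decTotalOrder using (sort-↭; sort-↗)
open import Data.List.Relation.Unary.Sorted.TotalOrder.Properties using (↗↭↗⇒≋)
open import Data.List.Relation.Binary.Equality.Propositional using (≋⇒≡)
open import Data.List.Relation.Binary.Permutation.Propositional using (_↭_; ↭-sym; ↭-trans; ↭⇒↭ₛ)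
open import Data.List.Relation.Unary.All using (All; []; _∷_)
import Data.List.Relation.Unary.All as All
open import Data.List.Relation.Unary.Any using (here; there)
import Data.List.Relation.Unary.Any as Any
open import Data.List.Relation.Unary.Linked using (Linked; [-]; _∷_)
open import Data.List.Relation.Unary.Unique.Propositional using (Unique)
import Data.List.Relation.Unary.Unique.DecPropositional as UniqueDec
open import Data.List.Membership.Propositional using (_∈_)
open import Data.List.Membership.Propositional.Properties
  using (∈-filter⁺; ∈-allFin; ∈-map⁺; ∈-concatMap⁺; ∈-++⁺ˡ; ∈-++⁺ʳ)
import Data.List.Membership.DecPropositional as MembershipDec
import Data.Product.Properties as Product
open import Data.Product using (_×_; _,_; proj₁; proj₂; ∃-syntax; swap)
open import Data.Sum using (inj₁; inj₂)
open import Data.Empty using (⊥-elim)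
open import Data.Vec using (Vec; lookup) renaming (_∷_ to _∷ᵛ_; [] to []ᵛ)
open import Function using (_∘_)
open import Function.Bundles using (_⇔_; mk⇔; Equivalence)
open import Function.Definitions using (Injective)
open import Relation.Binary.Definitions using (Decidable; DecidableEquality)
open import Relation.Unary using () renaming (Decidable to Decidable₁)
open import Relation.Binary.PropositionalEquality using (_≡_; _≢_; refl; sym; subst)
open import Relation.Nullary using (Dec; yes; no; ¬_; does; map′; ¬?)
open import Relation.Nullary.Decidable using (True; toWitness; _×-dec_; _⊎-dec_; _→-dec_)

decide : {P : Set} (d : Dec P) {t : True d} → P
decide d {t} = toWitness t

sort-↭⇒≡ : ∀ {xs ys : List ℕ} → xs ↭ ys → sort xs ≡ sort ys
sort-↭⇒≡ {xs} {ys} xs↭ys = ≋⇒≡ (↗↭↗⇒≋ ≤-totalOrder (sort-↗ xs) (sort-↗ ys)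
  (↭⇒↭ₛ (↭-trans (sort-↭ xs) (↭-trans xs↭ys (↭-sym (sort-↭ ys))))))

sort-≡⇒↭ : ∀ {xs ys : List ℕ} → sort xs ≡ sort ys → xs ↭ ys
sort-≡⇒↭ {xs} {ys} eq =
  ↭-trans (↭-sym (sort-↭ xs)) (subst (_↭ ys) (sym eq) (sort-↭ ys))

_↭?_ : Decidable {A = List ℕ} _↭_
xs ↭? ys = map′ sort-≡⇒↭ sort-↭⇒≡ (≡-dec ℕ._≟_ (sort xs) (sort ys))

_⇔-dec_ : ∀ {A B : Set} → Dec A → Dec B → Dec (A ⇔ B)
a? ⇔-dec b? = map′ (λ (to , from) → mk⇔ to from) (λ a⇔b → Equivalence.to a⇔b , Equivalence.from a⇔b)
  ((a? →-dec b?) ×-dec (b? →-dec a?))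

∈-filter-partition : ∀ {A : Set} {P : A → Set} (P? : Decidable₁ P) {x xs} →
  x ∈ xs → x ∈ filter P? xs ++ filter (¬? ∘ P?) xs
∈-filter-partition P? {x} x∈xs with P? x
... | yes Px = ∈-++⁺ˡ (∈-filter⁺ P? x∈xs Px)
... | no ¬Px = ∈-++⁺ʳ _ (∈-filter⁺ (¬? ∘ P?) x∈xs ¬Px)

EdgeIn? : ∀ es → Decidable (EdgeIn es)
EdgeIn? es u v = Any.any? (λ e → e ≟ (u , v) ⊎-dec e ≟ (v , u)) es
  where
  _≟_ : DecidableEquality (ℕ × ℕ)
  _≟_ = Product.≡-dec ℕ._≟_ ℕ._≟_

EdgeIn-all : ∀ {P : ℕ → ℕ → Set} {es} →
  All (λ e → P (proj₁ e) (proj₂ e) × P (proj₂ e) (proj₁ e)) es →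
  ∀ {u v} → EdgeIn es u v → P u v
EdgeIn-all ((Puv , _) ∷ _) (here (inj₁ refl)) = Puv
EdgeIn-all ((_ , Pvu) ∷ _) (here (inj₂ refl)) = Pvu
EdgeIn-all (_ ∷ Ps) (there uv∈es) = EdgeIn-all Ps uv∈es

EdgeIn-⊆ : ∀ es es′ → {True (All.all? (λ (u , v) → EdgeIn? es′ u v ×-dec EdgeIn? es′ v u) es)} →
  ∀ u v → EdgeIn es u v → EdgeIn es′ u v
EdgeIn-⊆ es es′ {t} u v = EdgeIn-all (toWitness t)

injective? : ∀ {m n} (f : Fin m → Fin n) → Dec (Injective _≡_ _≡_ f)
injective? f = map′ (λ inj {x} {y} → inj x y) (λ inj x y → inj)
  (Fin.all? λ x → Fin.all? λ y → f x Fin.≟ f y →-dec x Fin.≟ y)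

module Neighbourhoods {V : Set} {Adj : V → V → Set}
  (nb : V → List V) (nb-complete : ∀ u v → Adj u v → v ∈ nb u) where
  private module G = GraphNotions Adj

  walksFrom : ℕ → V → List (List V)
  walksFrom zero    a = [ a ∷ [] ]
  walksFrom (suc k) a = concatMap (λ b → map (a ∷_) (walksFrom k b)) (nb a)

  zip-Linked : ∀ a ys zs → All (λ (u , v) → Adj u v) (zip (a ∷ ys) (ys ++ zs)) → Linked Adj (a ∷ ys)
  zip-Linked a []       zs _          = [-]
  zip-Linked a (b ∷ ys) zs (ab ∷ abs) = ab ∷ zip-Linked b ys zs abs

  Linked⇒∈walksFrom : ∀ {a xs} → Linked Adj (a ∷ xs) → (a ∷ xs) ∈ walksFrom (length xs) a
  Linked⇒∈walksFrom [-] = here refl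
  Linked⇒∈walksFrom {a} {_ ∷ xs} (ab ∷ rest) =
    ∈-concatMap⁺ (λ b → map (a ∷_) (walksFrom (length xs) b))
      (Any.map (λ { refl → ∈-map⁺ (a ∷_) (Linked⇒∈walksFrom rest) }) (nb-complete _ _ ab))

  cycle∈walksFrom : ∀ {a xs} → G.IsCycle (a ∷ xs) → (a ∷ xs) ∈ walksFrom (length xs) a
  cycle∈walksFrom {a} {xs} (_ , _ , adjs) = Linked⇒∈walksFrom (zip-Linked a xs [ a ] adjs)

  hasDegree : (∀ u v → v ∈ nb u → Adj u v) → ∀ v → Unique (nb v) → G.HasDegree v (length (nb v))
  hasDegree nb-sound v unique = nb v , refl , unique , λ u → mk⇔ (nb-complete v u) (nb-sound v u)

  isTotalColoring-local : ∀ {k vc ec} → (∀ v → vc v ≤ k) →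
    (∀ u → All (λ v → ec u v ≤ k × ec u v ≡ ec v u × vc u ≢ vc v × ec u v ≢ vc u) (nb u)) →
    (∀ u → All (λ v → All (λ w → v ≢ w → ec u v ≢ ec u w) (nb u)) (nb u)) →
    G.IsTotalColoring k vc ec
  isTotalColoring-local {k} {vc} {ec} vc≤k edgeConds pairConds =
      vc≤k
    , (λ u v → proj₁ ∘ atEdge u v)
    , (λ u v → proj₁ ∘ proj₂ ∘ atEdge u v)
    , (λ u v → proj₁ ∘ proj₂ ∘ proj₂ ∘ atEdge u v)
    , (λ u v w uv uw → All.lookup (All.lookup (pairConds u) (nb-complete u v uv)) (nb-complete u w uw))
    , (λ u v → proj₂ ∘ proj₂ ∘ proj₂ ∘ atEdge u v)
    where
    atEdge : ∀ u v → Adj u v → ec u v ≤ k × ec u v ≡ ec v u × vc u ≢ vc v × ec u v ≢ vc u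
    atEdge u v uv = All.lookup (edgeConds u) (nb-complete u v uv)

chord : ℕ → ℕ
chord i = if does (i % 2 ℕ.≟ 0) then 4 else 8

-- Besides v_{i±1} on Σ, v_i has the neighbours v_{i±4} on P_0, P_1 (i even) or v_{i±8} on Q_0, Q_1 (i odd).
neighbours : Fin 20 → List (Fin 20)
neighbours v = map (λ d → (toℕ v + d) mod 20) (1 ∷ 19 ∷ chord (toℕ v) ∷ 20 ∸ chord (toℕ v) ∷ [])

open MembershipDec (Fin._≟_ {20}) using (_∈?_)

neighbours-sound : ∀ u v → v ∈ neighbours u → Adj u v
neighbours-sound = decide (Fin.all? λ u → Fin.all? λ v → v ∈? neighbours u →-dec EdgeIn? GammaE (toℕ u) (toℕ v))

neighbours-complete : ∀ u v → Adj u v → v ∈ neighbours u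
neighbours-complete = decide (Fin.all? λ u → Fin.all? λ v → EdgeIn? GammaE (toℕ u) (toℕ v) →-dec v ∈? neighbours u)

adj? : Decidable Adj
adj? u v = map′ (neighbours-sound u v) (neighbours-complete u v) (v ∈? neighbours u)

isCycle? : ∀ xs → Dec (IsCycle xs)
isCycle? xs = (3 ≤? length xs) ×-dec UniqueDec.unique? Fin._≟_ xs
         ×-dec All.all? (λ (a , b) → adj? a b) (closedPairs xs)

open Neighbourhoods neighbours neighbours-complete

regular : Regular 4
regular v = subst (HasDegree v) (decide (Fin.all? λ v → length (neighbours v) ℕ.≟ 4) v)
  (hasDegree neighbours-sound v (decide (Fin.all? λ v → UniqueDec.unique? Fin._≟_ (neighbours v)) v))

walksFrom-noCycle : ∀ k → {True (Fin.all? λ a → All.all? (¬? ∘ isCycle?) (walksFrom k a))} →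
  ∀ {a xs} → length xs ≡ k → ¬ IsCycle (a ∷ xs)
walksFrom-noCycle k {t} refl cyc = All.lookup (toWitness t _) (cycle∈walksFrom cyc) cyc

cycle-length-≥5 : ∀ xs → IsCycle xs → 5 ≤ length xs
cycle-length-≥5 [] (() , _)
cycle-length-≥5 (_ ∷ []) (s≤s () , _)
cycle-length-≥5 (_ ∷ _ ∷ []) (s≤s (s≤s ()) , _)
cycle-length-≥5 (_ ∷ _ ∷ _ ∷ [])     cyc = ⊥-elim (walksFrom-noCycle 2 refl cyc)
cycle-length-≥5 (_ ∷ _ ∷ _ ∷ _ ∷ []) cyc = ⊥-elim (walksFrom-noCycle 3 refl cyc)
cycle-length-≥5 (_ ∷ _ ∷ _ ∷ _ ∷ _ ∷ _) _ = s≤s (s≤s (s≤s (s≤s (s≤s z≤n))))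

girth : HasGirth 5
girth = (P0 , decide (isCycle? P0) , refl) , cycle-length-≥5
  where P0 = # 0 ∷ # 4 ∷ # 8 ∷ # 12 ∷ # 16 ∷ []

components-edgeDisjoint : ∀ (i j : Fin 5) → i ≢ j → ∀ u v → EdgeIn (component i) u v → ¬ EdgeIn (component j) u v
components-edgeDisjoint i j i≢j u v = EdgeIn-all (decide (Fin.all? λ i → Fin.all? λ j → ¬? (i Fin.≟ j) →-dec
  All.all? (λ (u , v) → ¬? (EdgeIn? (component j) u v) ×-dec ¬? (EdgeIn? (component j) v u))
           (component i)) i j i≢j)

Σ-decomposition : ∀ u v → EdgeIn (component Fin.zero) u v ⇔ EdgeIn (F00 ++ F01 ++ F10 ++ F11) u v
Σ-decomposition u v = mk⇔ (EdgeIn-⊆ _ _ u v) (EdgeIn-⊆ _ _ u v)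

IsPetersenEmbedding : List ℕ → List (ℕ × ℕ) → (Fin 10 → Fin 20) → Set
IsPetersenEmbedding vs es f =
    Injective _≡_ _≡_ f
  × (∀ a → toℕ (f a) ∈ vs)
  × (∀ (v : Fin 20) → toℕ v ∈ vs → ∃[ a ] (f a ≡ v))
  × (∀ a b → (PetersenAdj a b ⇔ EdgeIn es (toℕ (f a)) (toℕ (f b))))

isPetersenEmbedding? : ∀ vs es f → Dec (IsPetersenEmbedding vs es f)
isPetersenEmbedding? vs es f =
        injective? f
  ×-dec Fin.all? (λ a → toℕ (f a) ∈ℕ? vs)
  ×-dec Fin.all? (λ v → toℕ v ∈ℕ? vs →-dec Fin.any? λ a → f a Fin.≟ v)
  ×-dec Fin.all? (λ a → Fin.all? λ b →
          EdgeIn? petersenEdges (toℕ a) (toℕ b) ⇔-dec EdgeIn? es (toℕ (f a)) (toℕ (f b)))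
  where open MembershipDec ℕ._≟_ renaming (_∈?_ to _∈ℕ?_)

isoToPetersen : ∀ vs es (f : Vec (Fin 20) 10) → {True (isPetersenEmbedding? vs es (lookup f))} →
  IsoToPetersen vs es
isoToPetersen vs es f {t} = lookup f , toWitness t

totalColoring : IsTotalColoring 4 vcol ecol
totalColoring = isTotalColoring-local
  (decide (Fin.all? λ v → vcol v ≤? 4))
  (decide (Fin.all? λ u → All.all? (λ v → ecol u v ≤? 4 ×-dec ecol u v ℕ.≟ ecol v u
                                     ×-dec ¬? (vcol u ℕ.≟ vcol v) ×-dec ¬? (ecol u v ℕ.≟ vcol u)) (neighbours u)))
  (decide (Fin.all? λ u → All.all? (λ v → All.all? (λ w → ¬? (v Fin.≟ w) →-dec ¬? (ecol u v ℕ.≟ ecol u w))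
                                     (neighbours u)) (neighbours u)))

-- v_19 and v_4 both lie in N[v_0] and both receive colour 3.
notEfficient : ¬ IsEfficientTC 4 vcol ecol
notEfficient (_ , closedNbd-rainbow , _) =
  closedNbd-rainbow (# 0) (# 19) (# 4) (inj₂ (decide (adj? _ _))) (inj₂ (decide (adj? _ _))) (λ ()) refl

rainbow? : ∀ xs → Dec (Rainbow xs)
rainbow? xs = (_ ↭? _) ×-dec (_ ↭? _)

-- Canonicity is tested first: it is cheap and already rejects most walks.
fiveCycle? : ∀ xs → Dec (FiveCycle xs)
fiveCycle? xs = map′ swap swap (canonical5? xs ×-dec isCycle? xs)
  where
  canonical5? : ∀ xs → Dec (Canonical5 xs)
  canonical5? (a ∷ b ∷ c ∷ d ∷ e ∷ []) =
    a Fin.<? b ×-dec a Fin.<? c ×-dec a Fin.<? d ×-dec a Fin.<? e ×-dec b Fin.<? e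
  canonical5? []                          = no λ ()
  canonical5? (_ ∷ [])                    = no λ ()
  canonical5? (_ ∷ _ ∷ [])                = no λ ()
  canonical5? (_ ∷ _ ∷ _ ∷ [])            = no λ ()
  canonical5? (_ ∷ _ ∷ _ ∷ _ ∷ [])        = no λ ()
  canonical5? (_ ∷ _ ∷ _ ∷ _ ∷ _ ∷ _ ∷ _) = no λ ()

fiveCycles : List (List (Fin 20))
fiveCycles = filter fiveCycle? (concatMap (walksFrom 4) (allFin 20))

fiveCycle∈fiveCycles : ∀ xs → FiveCycle xs → xs ∈ fiveCycles
fiveCycle∈fiveCycles xs@(a ∷ _ ∷ _ ∷ _ ∷ _ ∷ []) fc@(cyc , _) = ∈-filter⁺ fiveCycle? walk∈ fc
  where
  walk∈ : xs ∈ concatMap (walksFrom 4) (allFin 20)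
  walk∈ = ∈-concatMap⁺ (walksFrom 4) (Any.map (λ { refl → cycle∈walksFrom cyc }) (∈-allFin a))

theorem35 :
    (∀ (i j : Fin 5) → i ≢ j → ∀ u v → EdgeIn (component i) u v → ¬ EdgeIn (component j) u v)
    × Regular 4
    × HasGirth 5
    × (∀ u v → (EdgeIn (component Fin.zero) u v ⇔ EdgeIn (F00 ++ F01 ++ F10 ++ F11) u v))
    × IsoToPetersen (P0V ++ Q0V) (PQF P0V Q0V F00)
    × IsoToPetersen (P0V ++ Q1V) (PQF P0V Q1V F01)
    × IsoToPetersen (P1V ++ Q0V) (PQF P1V Q0V F10)
    × IsoToPetersen (P1V ++ Q1V) (PQF P1V Q1V F11)
    × IsTotalColoring 4 vcol ecol
    × ¬ IsEfficientTC 4 vcol ecol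
    × (∃[ R ] ∃[ N ] ( (length R ≡ 14) × (length N ≡ 40)
        × Unique (R ++ N)
        × All FiveCycle (R ++ N)
        × (∀ xs → FiveCycle xs → xs ∈ (R ++ N))
        × All Rainbow R
        × All (λ xs → ¬ Rainbow xs) N ))
theorem35 =
    components-edgeDisjoint , regular , girth , Σ-decomposition
  , isoToPetersen _ _ (# 0 ∷ᵛ # 4 ∷ᵛ # 8 ∷ᵛ # 12 ∷ᵛ # 16 ∷ᵛ # 1 ∷ᵛ # 5 ∷ᵛ # 9 ∷ᵛ # 13 ∷ᵛ # 17 ∷ᵛ []ᵛ)
  , isoToPetersen _ _ (# 0 ∷ᵛ # 4 ∷ᵛ # 8 ∷ᵛ # 12 ∷ᵛ # 16 ∷ᵛ # 19 ∷ᵛ # 3 ∷ᵛ # 7 ∷ᵛ # 11 ∷ᵛ # 15 ∷ᵛ []ᵛ)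
  , isoToPetersen _ _ (# 2 ∷ᵛ # 6 ∷ᵛ # 10 ∷ᵛ # 14 ∷ᵛ # 18 ∷ᵛ # 1 ∷ᵛ # 5 ∷ᵛ # 9 ∷ᵛ # 13 ∷ᵛ # 17 ∷ᵛ []ᵛ)
  , isoToPetersen _ _ (# 2 ∷ᵛ # 6 ∷ᵛ # 10 ∷ᵛ # 14 ∷ᵛ # 18 ∷ᵛ # 3 ∷ᵛ # 7 ∷ᵛ # 11 ∷ᵛ # 15 ∷ᵛ # 19 ∷ᵛ []ᵛ)
  , totalColoring , notEfficient
  , filter rainbow? fiveCycles , filter (¬? ∘ rainbow?) fiveCycles , refl , refl
  , decide (UniqueDec.unique? (≡-dec Fin._≟_) (filter rainbow? fiveCycles ++ filter (¬? ∘ rainbow?) fiveCycles))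
  , All.++⁺ (All.filter⁺ rainbow? allFive) (All.filter⁺ (¬? ∘ rainbow?) allFive)
  , (λ xs → ∈-filter-partition rainbow? ∘ fiveCycle∈fiveCycles xs)
  , All.all-filter rainbow? fiveCycles
  , All.all-filter (¬? ∘ rainbow?) fiveCycles
  where
  allFive : All FiveCycle fiveCycles
  allFive = All.all-filter fiveCycle? (concatMap (walksFrom 4) (allFin 20))
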